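{- If $G$ is a graph of order $n$ with $\Delta(G)=n-1$, then $vs_{\chi'}(G)=1$ or $vs_{\chi'}(G)=2$.
   Context: All graphs are finite and simple. $\chi'$ is the chromatic index and $\Delta$ the maximum degree. The chromatic vertex stability number $vs_{\chi'}(G)$ of a nonempty graph $G$ is the minimum number of vertices of $G$ whose removal results in a graph $H\subseteq G$ with $\chi'(H)\neq\chi'(G)$ (or with no edges); if $G$ is empty, $vs_{\chi'}(G)=0$. -}

module Defs where

open import Data.Nat using (ℕ; _≤_; _⊔_)
open import Data.Bool using (Bool; true; false; _∧_; not)
open import Data.Fin using (Fin)
open import Data.Fin.Subset using (Subset; ∣_∣)
open import Data.Vec using (tabulate; lookup)
open import Data.List using (foldr; map; allFin)
open import Data.Product using (Σ; ∃; _×_; _,_)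
open import Data.Sum using (_⊎_)
open import Relation.Nullary using (¬_)
open import Relation.Binary.PropositionalEquality using (_≡_; _≢_)

record Graph (n : ℕ) : Set where
  field
    adj     : Fin n → Fin n → Bool
    adj-sym : ∀ u v → adj u v ≡ adj v u
    adj-irr : ∀ v → adj v v ≡ false
open Graph public

Edge : ∀ {n} → Graph n → Fin n → Fin n → Set
Edge G u v = adj G u v ≡ true

degree : ∀ {n} → Graph n → Fin n → ℕ
degree G v = ∣ tabulate (adj G v) ∣

maxDegree : ∀ {n} → Graph n → ℕ
maxDegree {n} G = foldr _⊔_ 0 (map (degree G) (allFin n))

Edgeless : ∀ {n} → Graph n → Set
Edgeless {n} G = ∀ (u v : Fin n) → ¬ Edge G u v

record EdgeColouring {n} (G : Graph n) (k : ℕ) : Set where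
  field
    col       : Fin n → Fin n → Fin k
    col-sym   : ∀ u v → Edge G u v → col u v ≡ col v u
    col-proper : ∀ u v w → Edge G u v → Edge G u w → v ≢ w → col u v ≢ col u w

IsChromaticIndex : ∀ {n} → Graph n → ℕ → Set
IsChromaticIndex G k = EdgeColouring G k × (∀ j → EdgeColouring G j → k ≤ j)

-- G - S : remove the vertices of S (S v = true means v is removed).
-- Removed vertices are kept as isolated vertices, which changes neither
-- the chromatic index nor edgelessness.
removeVertices : ∀ {n} → Graph n → Subset n → Graph n
removeVertices {n} G S = record
  { adj     = λ u v → not (lookup S u) ∧ not (lookup S v) ∧ adj G u v
  ; adj-sym = sym'
  ; adj-irr = irr'
  }
  where
  open import Relation.Binary.PropositionalEquality using (refl; cong₂; cong)
  open import Data.Bool.Properties using (∧-comm; ∧-assoc)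
  sym' : ∀ u v → (not (lookup S u) ∧ not (lookup S v) ∧ adj G u v)
               ≡ (not (lookup S v) ∧ not (lookup S u) ∧ adj G v u)
  sym' u v with lookup S u | lookup S v
  ... | true  | true  = refl
  ... | true  | false = refl
  ... | false | true  = refl
  ... | false | false = adj-sym G u v
  irr' : ∀ v → (not (lookup S v) ∧ not (lookup S v) ∧ adj G v v) ≡ false
  irr' v with lookup S v
  ... | true  = refl
  ... | false = adj-irr G v

Destabilising : ∀ {n} → Graph n → Subset n → Set
Destabilising G S =
  (∀ a b → IsChromaticIndex G a → IsChromaticIndex (removeVertices G S) b → a ≢ b)
  ⊎ Edgeless (removeVertices G S)

-- vs_χ'(G) = m : minimum size of a destabilising vertex set.
-- (If G is edgeless, S = ∅ is destabilising, so vs = 0 as required.)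
IsVertexStability : ∀ {n} → Graph n → ℕ → Set
IsVertexStability {n} G m =
  (Σ (Subset n) λ S → ∣ S ∣ ≡ m × Destabilising G S)
  × (∀ (S : Subset n) → Destabilising G S → m ≤ ∣ S ∣)

module Submission where

-- A vertex v of degree n − 1 is universal, so its n − 1 edges need distinct
-- colours and χ'(G) ≥ n − 1.  Removing any two vertices leaves edges on only
-- n − 2 vertices; labelling those injectively by Z/(n−2) and colouring uv by
-- label(u) + label(v) gives a proper colouring with n − 2 colours, so χ'
-- drops (for n = 2 no edge survives).  Since G has an edge, removing nothing
-- is never destabilising.  Hence vs_χ' is 1 or 2, according to whether some
-- single vertex is destabilising; this is decidable because χ' of a finite
-- graph is computable by exhaustive search over colour functions.

open import Defs
open import Data.Nat using (ℕ; zero; suc; _+_; _*_; _∸_; _⊔_; _≤_; _<_; z≤n; s≤s; _≟_)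
open import Data.Nat.Properties
  using (≤-antisym; ≤-trans; ≤-reflexive; suc-injective; ≤-<-trans; ≰⇒>; 1+n≰n; +-comm; +-assoc; m+[n∸m]≡n; m+n∸n≡m; ⊔-sel)
open import Data.Nat.DivMod using (_%_; _mod_; %-distribˡ-+; %-congˡ; %-remove-+ʳ; m<n⇒m%n≡m; m%n≤n; m≡m%n+[m/n]*n; _/_)
open import Data.Nat.Divisibility using (_∣_; divides)
open import Data.Bool using (true; false)
import Data.Bool as Bool
open import Data.Fin using (Fin; zero; suc; toℕ; combine; remQuot; inject≤; punchIn)
import Data.Fin as Fin
open import Data.Fin.Properties
  using (any?; all?; remQuot-combine; toℕ<n; inject≤-injective; toℕ-injective; toℕ-fromℕ<;
         injective⇒≤; punchIn-injective; punchInᵢ≢i)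
open import Data.Fin.Subset using (Subset; ∣_∣; ⊥; ⁅_⁆; ∁; _∈_; inside; outside)
open import Data.Fin.Subset.Properties
  using (∣⊥∣≡0; ∣⁅x⁆∣≡1; ∣∁p∣≡n∸∣p∣; x∈p⇒∣p-x∣<∣p∣; x∈p∧x≢y⇒x∈p-y; x∉p⇒x∈∁p)
open import Data.Vec using ([]; _∷_; lookup; tabulate)
open import Data.Vec.Properties using (lookup-replicate; lookup∘tabulate; []=⇒lookup)
import Data.Vec.Functional as Vector
open import Data.List using (List; []; _∷_; foldr; map; allFin)
open import Data.Product using (Σ; ∃; _×_; _,_; proj₁; proj₂; uncurry)
open import Data.Sum using (_⊎_; inj₁; inj₂)
open import Data.Empty using (⊥-elim)
open import Function using (_∘_)
open import Relation.Nullary using (¬_; Dec; yes; no)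
open import Relation.Nullary.Decidable using (map′; ¬?; _×-dec_; _⊎-dec_; _→-dec_)
open import Relation.Binary.PropositionalEquality
  using (_≡_; _≢_; _≗_; refl; sym; trans; cong; subst; module ≡-Reasoning)

Extensional : ∀ {m k} → ((Fin m → Fin k) → Set) → Set
Extensional P = ∀ {f g} → f ≗ g → P f → P g

anyFunction? : ∀ m {k} (P : (Fin m → Fin k) → Set) →
  Extensional P → (∀ f → Dec (P f)) → Dec (∃ P)
anyFunction? zero P ext P? =
  map′ (λ p → empty , p) (λ (f , pf) → ext (λ ()) pf) (P? empty)
  where
  empty : Fin 0 → _
  empty ()
anyFunction? (suc m) P ext P? =
  map′ (λ (a , g , p) → a Vector.∷ g , p)
       (λ (f , pf) → f zero , Vector.tail f , ext splitHead pf)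
       (any? λ a → anyFunction? m (λ g → P (a Vector.∷ g)) (ext ∘ extendTail) (P? ∘ (a Vector.∷_)))
  where
  splitHead : ∀ {f : Fin (suc m) → _} → f ≗ (f zero Vector.∷ Vector.tail f)
  splitHead zero    = refl
  splitHead (suc i) = refl
  extendTail : ∀ {a} {g h : Fin m → _} → g ≗ h → (a Vector.∷ g) ≗ (a Vector.∷ h)
  extendTail g≗h zero    = refl
  extendTail g≗h (suc i) = g≗h i

module _ {n : ℕ} (G : Graph n) where

  edge? : ∀ u v → Dec (Edge G u v)
  edge? u v = adj G u v Bool.≟ true

  edgeless? : Dec (Edgeless G)
  edgeless? = all? λ u → all? λ v → ¬? (edge? u v)

  IsProper : ∀ {k} → (Fin n → Fin n → Fin k) → Set
  IsProper col = (∀ u v → Edge G u v → col u v ≡ col v u)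
               × (∀ u v w → Edge G u v → Edge G u w → v ≢ w → col u v ≢ col u w)

  isProper? : ∀ {k} (col : Fin n → Fin n → Fin k) → Dec (IsProper col)
  isProper? col =
    (all? λ u → all? λ v → edge? u v →-dec (col u v Fin.≟ col v u))
    ×-dec
    (all? λ u → all? λ v → all? λ w →
       edge? u v →-dec (edge? u w →-dec (¬? (v Fin.≟ w) →-dec ¬? (col u v Fin.≟ col u w))))

  isProper-cong : ∀ {k} {c c′ : Fin n → Fin n → Fin k} →
    (∀ u v → c u v ≡ c′ u v) → IsProper c → IsProper c′
  isProper-cong {c = c} {c′} c≡c′ (symmetric , proper) =
    (λ u v E → trans (sym (c≡c′ u v)) (trans (symmetric u v E) (c≡c′ v u))) ,
    (λ u v w Ev Ew v≢w eq → proper u v w Ev Ew v≢w (trans (c≡c′ u v) (trans eq (sym (c≡c′ u w)))))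

  -- Having a proper k-edge colouring is decidable: search over the colour
  -- functions, encoded as functions on the n·n ordered pairs of vertices.
  edgeColouring? : ∀ k → Dec (EdgeColouring G k)
  edgeColouring? k =
    map′ (λ (c , (symmetric , proper)) →
            record { col = onPairs c ; col-sym = symmetric ; col-proper = proper })
         (λ ec → let open EdgeColouring ec in
            encode col , isProper-cong (λ u v → sym (decode-encode col u v)) (col-sym , col-proper))
         (anyFunction? (n * n) (IsProper ∘ onPairs)
            (λ c≗c′ → isProper-cong (λ u v → c≗c′ (combine u v)))
            (isProper? ∘ onPairs))
    where
    onPairs : (Fin (n * n) → Fin k) → Fin n → Fin n → Fin k
    onPairs c u v = c (combine u v)
    encode : (Fin n → Fin n → Fin k) → Fin (n * n) → Fin k
    encode col = uncurry col ∘ remQuot n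
    decode-encode : ∀ col u v → onPairs (encode col) u v ≡ col u v
    decode-encode col u v = cong (uncurry col) (remQuot-combine u v)

  moreColours : ∀ {j k} → j ≤ k → EdgeColouring G j → EdgeColouring G k
  moreColours j≤k ec = record
    { col        = λ u v → inject≤ (col u v) j≤k
    ; col-sym    = λ u v E → cong (λ c → inject≤ c j≤k) (col-sym u v E)
    ; col-proper = λ u v w Ev Ew v≢w eq →
        col-proper u v w Ev Ew v≢w (inject≤-injective j≤k j≤k _ _ eq)
    }
    where open EdgeColouring ec

leastWitness : (P : ℕ → Set) → (∀ k → Dec (P k)) → (∀ {j k} → j ≤ k → P j → P k) →
  ∀ K → P K → Σ ℕ λ k → P k × (∀ j → P j → k ≤ j)
leastWitness P P? upward zero    p = zero , p , λ _ _ → z≤n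
leastWitness P P? upward (suc K) p with P? K
... | yes q = leastWitness P P? upward K q
... | no ¬q = suc K , p , λ j pj → ≰⇒> (λ j≤K → ¬q (upward j≤K pj))

_⊕_ : ∀ {M} → Fin (suc M) → Fin (suc M) → Fin (suc M)
_⊕_ {M} a b = (toℕ a + toℕ b) mod suc M

⊕-comm : ∀ {M} (a b : Fin (suc M)) → a ⊕ b ≡ b ⊕ a
⊕-comm {M} a b = cong (λ t → t mod suc M) (+-comm (toℕ a) (toℕ b))

-- Adding a fixed a is injective on residues mod N = M + 1: adding
-- t = N − (a mod N) afterwards turns a + b into b + (a + t) with N ∣ a + t,
-- which recovers b.
+-%-cancelˡ : ∀ {M} a {b c} → b < suc M → c < suc M →
  (a + b) % suc M ≡ (a + c) % suc M → b ≡ c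
+-%-cancelˡ {M} a {b} {c} b<M c<M eq = begin
  b                             ≡⟨ undo b<M ⟨
  (a + b + t) % N               ≡⟨ %-distribˡ-+ (a + b) t N ⟩
  ((a + b) % N + t % N) % N     ≡⟨ cong (λ r → (r + t % N) % N) eq ⟩
  ((a + c) % N + t % N) % N     ≡⟨ %-distribˡ-+ (a + c) t N ⟨
  (a + c + t) % N               ≡⟨ undo c<M ⟩
  c                             ∎
  where
  open ≡-Reasoning
  N t q : ℕ
  N = suc M
  t = N ∸ a % N
  q = a / N
  N∣a+t : N ∣ a + t
  N∣a+t = divides (suc q) (begin
    a + t                 ≡⟨ cong (_+ t) (m≡m%n+[m/n]*n a N) ⟩
    a % N + q * N + t     ≡⟨ cong (_+ t) (+-comm (a % N) (q * N)) ⟩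
    q * N + a % N + t     ≡⟨ +-assoc (q * N) (a % N) t ⟩
    q * N + (a % N + t)   ≡⟨ cong (q * N +_) (m+[n∸m]≡n (m%n≤n a N)) ⟩
    q * N + N             ≡⟨ +-comm (q * N) N ⟩
    suc q * N             ∎)
  undo : ∀ {x} → x < N → (a + x + t) % N ≡ x
  undo {x} x<N = begin
    (a + x + t) % N       ≡⟨ %-congˡ (trans (cong (_+ t) (+-comm a x)) (+-assoc x a t)) ⟩
    (x + (a + t)) % N     ≡⟨ %-remove-+ʳ x N∣a+t ⟩
    x % N                 ≡⟨ m<n⇒m%n≡m x<N ⟩
    x                     ∎

⊕-cancelˡ : ∀ {M} (a b c : Fin (suc M)) → a ⊕ b ≡ a ⊕ c → b ≡ c
⊕-cancelˡ a b c eq = toℕ-injective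
  (+-%-cancelˡ (toℕ a) (toℕ<n b) (toℕ<n c)
     (trans (sym (toℕ-fromℕ< _)) (trans (cong toℕ eq) (toℕ-fromℕ< _))))

NeighbourhoodInjective : ∀ {n k} → Graph n → (Fin n → Fin k) → Set
NeighbourhoodInjective G f = ∀ u x y → Edge G u x → Edge G u y → f x ≡ f y → x ≡ y

labelColouring : ∀ {n M} (G : Graph n) (f : Fin n → Fin (suc M)) →
  NeighbourhoodInjective G f → EdgeColouring G (suc M)
labelColouring G f injective = record
  { col        = λ u v → f u ⊕ f v
  ; col-sym    = λ u v _ → ⊕-comm (f u) (f v)
  ; col-proper = λ u v w Ev Ew v≢w eq →
      v≢w (injective u v w Ev Ew (⊕-cancelˡ (f u) (f v) (f w) eq))
  }

vertexColouring : ∀ {n} (G : Graph n) → EdgeColouring G n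
vertexColouring {zero}  G = record { col = λ () ; col-sym = λ () ; col-proper = λ () }
vertexColouring {suc n} G = labelColouring G (λ x → x) (λ _ _ _ _ _ eq → eq)

chromaticIndex : ∀ {n} (G : Graph n) → Σ ℕ (IsChromaticIndex G)
chromaticIndex {n} G =
  leastWitness (EdgeColouring G) (edgeColouring? G) (moreColours G) n (vertexColouring G)

recolour : ∀ {n k} {G H : Graph n} → (∀ u v → adj G u v ≡ adj H u v) →
  EdgeColouring G k → EdgeColouring H k
recolour same ec = record
  { col        = col
  ; col-sym    = λ u v E → col-sym u v (trans (same u v) E)
  ; col-proper = λ u v w Ev Ew → col-proper u v w (trans (same u v) Ev) (trans (same u w) Ew)
  }
  where open EdgeColouring ec

chromaticIndex-cong : ∀ {n a b} {G H : Graph n} → (∀ u v → adj G u v ≡ adj H u v) →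
  IsChromaticIndex G a → IsChromaticIndex H b → a ≡ b
chromaticIndex-cong {a = a} {b} same (colG , leastG) (colH , leastH) =
  ≤-antisym (leastG b (recolour (λ u v → sym (same u v)) colH)) (leastH a (recolour same colG))

module _ {n : ℕ} (G : Graph n) where

  removed-isolated : ∀ S u x → lookup S x ≡ true → ¬ Edge (removeVertices G S) u x
  removed-isolated S u x x∈S E with lookup S u | lookup S x
  removed-isolated S u x x∈S () | true  | _
  removed-isolated S u x x∈S () | false | true
  removed-isolated S u x ()  E  | false | false

  removeNothing : ∀ u v → adj (removeVertices G ⊥) u v ≡ adj G u v
  removeNothing u v rewrite lookup-replicate u outside | lookup-replicate v outside = refl

  destabilising? : ∀ S → Dec (Destabilising G S)
  destabilising? S = changes? ⊎-dec edgeless? (removeVertices G S)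
    where
    H : Graph n
    H = removeVertices G S
    changes? : Dec (∀ a b → IsChromaticIndex G a → IsChromaticIndex H b → a ≢ b)
    changes? with chromaticIndex G | chromaticIndex H
    ... | a , χa | b , χb =
      map′ (λ a≢b a′ b′ χa′ χb′ a′≡b′ →
              a≢b (trans (chromaticIndex-cong (λ _ _ → refl) χa χa′)
                  (trans a′≡b′ (chromaticIndex-cong (λ _ _ → refl) χb′ χb))))
           (λ differ → differ a b χa χb)
           (¬? (a ≟ b))

  removeNothing-stable : ∀ {u v} → Edge G u v → ¬ Destabilising G ⊥
  removeNothing-stable E (inj₁ differ) with chromaticIndex G | chromaticIndex (removeVertices G ⊥)
  ... | a , χa | b , χb = differ a b χa χb (chromaticIndex-cong (λ u v → sym (removeNothing u v)) χa χb)
  removeNothing-stable {u} {v} E (inj₂ edgeless) = edgeless u v (trans (removeNothing u v) E)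

card0⇒⊥ : ∀ {n} (p : Subset n) → ∣ p ∣ ≡ 0 → p ≡ ⊥
card0⇒⊥ []          _    = refl
card0⇒⊥ (false ∷ p) ∣p∣≡0 = cong (false ∷_) (card0⇒⊥ p ∣p∣≡0)

card1⇒singleton : ∀ {n} (p : Subset n) → ∣ p ∣ ≡ 1 → ∃ λ x → p ≡ ⁅ x ⁆
card1⇒singleton (true ∷ p)  ∣p∣≡1 = zero , cong (true ∷_) (card0⇒⊥ p (suc-injective ∣p∣≡1))
card1⇒singleton (false ∷ p) ∣p∣≡1 with card1⇒singleton p ∣p∣≡1
... | x , p≡⁅x⁆ = suc x , cong (false ∷_) p≡⁅x⁆

destabilising-nonempty : ∀ {n} (G : Graph n) {u v} → Edge G u v →
  ∀ S → Destabilising G S → 1 ≤ ∣ S ∣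
destabilising-nonempty G E S d with ∣ S ∣ in ∣S∣≡0
... | zero  = ⊥-elim (removeNothing-stable G E (subst (Destabilising G) (card0⇒⊥ S ∣S∣≡0) d))
... | suc _ = s≤s z≤n

vs-one-or-two : ∀ {n} (G : Graph n) {u v} → Edge G u v →
  (S₂ : Subset n) → ∣ S₂ ∣ ≡ 2 → Destabilising G S₂ →
  IsVertexStability G 1 ⊎ IsVertexStability G 2
vs-one-or-two G E S₂ ∣S₂∣≡2 S₂-destabilising with any? (λ x → destabilising? G ⁅ x ⁆)
... | yes (x , single) = inj₁ ((⁅ x ⁆ , ∣⁅x⁆∣≡1 x , single) , destabilising-nonempty G E)
... | no noSingle = inj₂ ((S₂ , ∣S₂∣≡2 , S₂-destabilising) , atLeastTwo)
  where
  atLeastTwo : ∀ S → Destabilising G S → 2 ≤ ∣ S ∣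
  atLeastTwo S d with ∣ S ∣ in ∣S∣≡1 | destabilising-nonempty G E S d
  ... | suc zero    | _ = let x , S≡⁅x⁆ = card1⇒singleton S ∣S∣≡1
                          in ⊥-elim (noSingle (x , subst (Destabilising G) S≡⁅x⁆ d))
  ... | suc (suc _) | _ = s≤s (s≤s z≤n)

maxAttained : ∀ {A : Set} (f : A → ℕ) (xs : List A) {k} →
  foldr _⊔_ 0 (map f xs) ≡ suc k → ∃ λ x → f x ≡ suc k
maxAttained f []       ()
maxAttained f (x ∷ xs) max≡ with ⊔-sel (f x) (foldr _⊔_ 0 (map f xs))
... | inj₁ max≡fx   = x , trans (sym max≡fx) max≡
... | inj₂ max≡rest = maxAttained f xs (trans (sym max≡rest) max≡)

two-members : ∀ {n} {p : Subset n} {x y} → x ∈ p → y ∈ p → x ≢ y → 2 ≤ ∣ p ∣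
two-members x∈p y∈p x≢y =
  ≤-<-trans (≤-<-trans z≤n (x∈p⇒∣p-x∣<∣p∣ (x∈p∧x≢y⇒x∈p-y y∈p (x≢y ∘ sym))))
            (x∈p⇒∣p-x∣<∣p∣ x∈p)

Universal : ∀ {n} → Graph n → Fin n → Set
Universal G v = ∀ u → u ≢ v → Edge G v u

-- A vertex of degree n − 1 is universal: a further non-neighbour u ≠ v
-- would put two elements outside its neighbourhood, leaving at most n − 2.
full-degree⇒universal : ∀ {m} (G : Graph (suc m)) v → degree G v ≡ m → Universal G v
full-degree⇒universal {m} G v deg u u≢v with adj G v u in v≁u
... | true  = refl
... | false = ⊥-elim (1+n≰n (≤-trans (two-members (outside-nbhd u v≁u) (outside-nbhd v (adj-irr G v)) u≢v)
                                      (≤-reflexive ∣∁nbhd∣≡1)))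
  where
  nbhd : Subset (suc m)
  nbhd = tabulate (adj G v)
  outside-nbhd : ∀ x → adj G v x ≡ false → x ∈ ∁ nbhd
  outside-nbhd x v≁x = x∉p⇒x∈∁p λ x∈nbhd →
    falseNotTrue (trans (sym v≁x) (trans (sym (lookup∘tabulate (adj G v) x)) ([]=⇒lookup x∈nbhd)))
    where
    falseNotTrue : false ≢ true
    falseNotTrue ()
  ∣∁nbhd∣≡1 : ∣ ∁ nbhd ∣ ≡ 1
  ∣∁nbhd∣≡1 = trans (∣∁p∣≡n∸∣p∣ nbhd) (trans (cong (suc m ∸_) deg) (m+n∸n≡m 1 m))

-- Edges at a universal vertex need distinct colours, so every edge colouring
-- of a graph of order m + 1 with a universal vertex uses at least m colours.
universal⇒colours : ∀ {m} (G : Graph (suc m)) v → Universal G v →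
  ∀ {k} → EdgeColouring G k → m ≤ k
universal⇒colours G v universal ec = injective⇒≤ colourAt-v-injective
  where
  open EdgeColouring ec
  colourAt-v : Fin _ → Fin _
  colourAt-v i = col v (punchIn v i)
  colourAt-v-injective : ∀ {i j} → colourAt-v i ≡ colourAt-v j → i ≡ j
  colourAt-v-injective {i} {j} same with punchIn v i Fin.≟ punchIn v j
  ... | yes eq = punchIn-injective v i j eq
  ... | no ne  = ⊥-elim (col-proper v _ _ (universal _ (punchInᵢ≢i v i))
                                          (universal _ (punchInᵢ≢i v j)) ne same)

firstTwo : ∀ {m} → Subset (suc (suc m))
firstTwo = inside ∷ inside ∷ ⊥

∣firstTwo∣≡2 : ∀ m → ∣ firstTwo {m} ∣ ≡ 2
∣firstTwo∣≡2 m = cong (λ c → suc (suc c)) (∣⊥∣≡0 m)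

-- Removing two vertices from a graph with a universal vertex is destabilising:
-- for order 2 no edge is left; for order k + 3, χ' drops from ≥ k + 2 to
-- ≤ k + 1, by labelling the remaining vertices with Fin (k + 1).
firstTwo-destabilising : ∀ m (G : Graph (suc (suc m))) v → Universal G v →
  Destabilising G firstTwo
firstTwo-destabilising zero G _ _ = inj₂ λ u x → removed-isolated G firstTwo u x (removed x)
  where
  removed : ∀ x → lookup firstTwo x ≡ true
  removed zero       = refl
  removed (suc zero) = refl
firstTwo-destabilising (suc k) G v universal =
  inj₁ λ a b (colG , _) (_ , leastH) a≡b →
    1+n≰n (≤-trans (universal⇒colours G v universal colG)
          (≤-trans (≤-reflexive a≡b) (leastH (suc k) (labelColouring H dropTwo dropTwo-injective))))
  where
  H : Graph (suc (suc (suc k)))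
  H = removeVertices G firstTwo
  dropTwo : Fin (suc (suc (suc k))) → Fin (suc k)
  dropTwo zero          = zero
  dropTwo (suc zero)    = zero
  dropTwo (suc (suc i)) = i
  isolated : ∀ u x → lookup firstTwo x ≡ true → ¬ Edge H u x
  isolated = removed-isolated G firstTwo
  -- Only vertices 2, 3, … have neighbours in H, and dropTwo is injective on them.
  dropTwo-injective : NeighbourhoodInjective H dropTwo
  dropTwo-injective u zero          _             Ex _  _   = ⊥-elim (isolated u zero refl Ex)
  dropTwo-injective u (suc zero)    _             Ex _  _   = ⊥-elim (isolated u (suc zero) refl Ex)
  dropTwo-injective u (suc (suc i)) zero          _  Ey _   = ⊥-elim (isolated u zero refl Ey)
  dropTwo-injective u (suc (suc i)) (suc zero)    _  Ey _   = ⊥-elim (isolated u (suc zero) refl Ey)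
  dropTwo-injective u (suc (suc i)) (suc (suc j)) _  _  i≡j = cong (λ i → suc (suc i)) i≡j

mainTheorem11 : (n : ℕ) → 2 ≤ n → (G : Graph n) → maxDegree G ≡ n ∸ 1 →
    IsVertexStability G 1 ⊎ IsVertexStability G 2
mainTheorem11 (suc (suc m)) (s≤s (s≤s z≤n)) G Δ≡n-1 =
  vs-one-or-two G (universal (punchIn v zero) (punchInᵢ≢i v zero))
    firstTwo (∣firstTwo∣≡2 m) (firstTwo-destabilising m G v universal)
  where
  maxDegreeVertex : ∃ λ v → degree G v ≡ suc m
  maxDegreeVertex = maxAttained (degree G) (allFin _) Δ≡n-1
  v : Fin (suc (suc m))
  v = proj₁ maxDegreeVertex
  universal : Universal G v
  universal = full-degree⇒universal G v (proj₂ maxDegreeVertex)
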